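{- For $n\ge2$ and $d\ge2$, let $H_{n,d}$ be the number of hoe permutations in $S^d_n$ (defined in the context). Then \[H_{n,d}=\sum_{k=0}^{n-2}\left(2^{d-1}-1\right)^k.\]
   Context: For $n\ge1$, $S_n$ is the set of permutations of $\{0,\dots,n-1\}$ in one-line notation. For $d\ge2$, $S^d_n$ is the set of $(d-1)$-tuples $\Pi=(\pi^2,\dots,\pi^d)$ of elements of $S_n$; its elements are the columns $\Pi_j=(\pi^2_j,\dots,\pi^d_j)^T$, and the level of $\Pi_j$ is $\mathrm{lev}(\Pi_j)=\max\{\pi^2_j,\dots,\pi^d_j\}$. An ascent (resp. descent) of $\Pi$ is an index $j$ with $\mathrm{lev}(\Pi_j)<\mathrm{lev}(\Pi_{j+1})$ (resp. $>$). $\Pi$ is unimodal if its level vector consists of (possibly zero) ascents followed by (possibly zero) descents, i.e. $\mathrm{lev}(\Pi_1)<\dots<\mathrm{lev}(\Pi_m)>\mathrm{lev}(\Pi_{m+1})>\dots>\mathrm{lev}(\Pi_n)$ for some $m$. $\Pi$ is a hoe permutation if it is unimodal and has exactly one descent, located at position $n-1$, i.e. $\mathrm{lev}(\Pi_1)<\mathrm{lev}(\Pi_2)<\dots<\mathrm{lev}(\Pi_{n-1})>\mathrm{lev}(\Pi_n)$. -}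

module Defs where

open import Data.Nat using (ℕ; zero; suc; _<ᵇ_; _⊔_; _∸_; _^_)
open import Data.Bool using (Bool; true; false; _∧_; if_then_else_)
open import Data.Fin using (Fin; toℕ)
open import Data.Fin.Properties using (_≟_)
open import Data.List using (List; []; _∷_; map; concatMap; filter; length; allFin; upTo)
open import Data.Nat.ListAction using (sum)
open import Data.Bool.ListAction using (all)
open import Data.Vec using (Vec; []; _∷_; lookup; toList; foldr)
open import Relation.Nullary.Decidable using (⌊_⌋)
open import Data.Bool.Properties using (T?)

allVecs : {A : Set} → List A → (k : ℕ) → List (Vec A k)
allVecs xs zero = [] ∷ []
allVecs xs (suc k) = concatMap (λ x → map (x ∷_) (allVecs xs k)) xs

occ : {n k : ℕ} → Fin n → Vec (Fin n) k → ℕ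
occ i [] = 0
occ i (x ∷ v) = (if ⌊ x ≟ i ⌋ then 1 else 0) Data.Nat.+ occ i v

-- a word of length n over {0..n-1} is a permutation (one-line notation)
-- iff every value i in {0..n-1} occurs exactly once
isPerm : {n : ℕ} → Vec (Fin n) n → Bool
isPerm {n} v = all (λ i → ⌊ occ i v Data.Nat.≟ 1 ⌋) (allFin n)

S : (n : ℕ) → List (Vec (Fin n) n)
S n = filter (λ v → T? (isPerm v)) (allVecs (allFin n) n)

-- S^d_n : (d-1)-tuples (π², …, π^d) of elements of S_n
Sd : (n d : ℕ) → List (Vec (Vec (Fin n) n) (d ∸ 1))
Sd n d = allVecs (S n) (d ∸ 1)

lev : {n m : ℕ} → Vec (Vec (Fin n) n) m → Fin n → ℕ
lev Π j = foldr (λ _ → ℕ) (λ π acc → toℕ (lookup π j) ⊔ acc) 0 Π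

levels : {n m : ℕ} → Vec (Vec (Fin n) n) m → List ℕ
levels {n} Π = map (lev Π) (allFin n)

hoeList : List ℕ → Bool
hoeList [] = false
hoeList (x ∷ []) = false
hoeList (x ∷ y ∷ []) = y <ᵇ x
hoeList (x ∷ y ∷ z ∷ r) = (x <ᵇ y) ∧ hoeList (y ∷ z ∷ r)

isHoe : {n m : ℕ} → Vec (Vec (Fin n) n) m → Bool
isHoe Π = hoeList (levels Π)

H : ℕ → ℕ → ℕ
H n d = length (filter (λ Π → T? (isHoe Π)) (Sd n d))

rhs : ℕ → ℕ → ℕ
rhs n d = sum (map (λ k → (2 ^ (d ∸ 1) ∸ 1) ^ k) (upTo (n ∸ 1)))

-- In a tuple of permutations of {0, …, n + 1}, a column has the top level n + 1 exactly when some permutation has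
-- its maximum n + 1 there. Deleting the maximum from every permutation gives a tuple of permutations of {0, …, n},
-- and once the positions of the deleted maxima are fixed this is a bijection that leaves the levels before those
-- positions unchanged. Let A_k (resp. C_k) count the tuples in S^d_k whose levels rise along the first k − 1 columns
-- (resp. along all k columns), and number columns from 0. Every maximum in a hoe tuple of S^d_{n+2} sits at the
-- peak n, so H_{n+2} = A_{n+1}. In a tuple counted by A_{n+2} every maximum sits at position n or n + 1; recording
-- which by a vector in {0,1}^{d−1}, the all-(n + 1) vector leaves a tuple counted by C_{n+1} and each of the other
-- 2^{d−1} − 1 vectors one counted by A_{n+1}. With C_{n+2} = C_{n+1} (all maxima are last) and A_1 = C_1 = 1,
-- this gives A_{n+1} = Σ_{k ≤ n} (2^{d−1} − 1)^k.

module Submission where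

open import Defs
import Data.Nat.Properties as ℕ
open import Algebra.Properties.CommutativeSemigroup ℕ.+-commutativeSemigroup using (x∙yz≈y∙xz)
open import Data.Bool using (Bool; true; false; T; not; _∧_; if_then_else_)
open import Data.Bool.ListAction using (all)
open import Data.Bool.Properties using (T?; T-∧; ∧-identityʳ; ∧-zeroʳ)
open import Data.Empty using (⊥-elim)
open import Data.Fin using (Fin; zero; suc; toℕ; fromℕ; inject₁; punchOut)
open import Data.Fin.Properties
  using (_≟_; toℕ-injective; toℕ-inject₁; toℕ-fromℕ; toℕ<n; fromℕ≢inject₁; inject₁-injective; punchIn-punchOut)
open import Data.List as List
  using (List; []; _∷_; filter; length; _++_; cartesianProductWith; cartesianProduct; concatMap; allFin; applyUpTo; upTo)
open import Data.List.Properties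
  using (length-map; length-++; filter-++; filter-all; filter-none; map-id-local; map-applyUpTo)
import Data.List.Properties as List
open import Data.List.Membership.Propositional using (_∈_)
open import Data.List.Membership.Propositional.Properties
  using (∈-allFin; ∈-filter⁺; ∈-filter⁻; ∈-map⁺; ∈-map⁻; ∈-cartesianProductWith⁺; ∈-cartesianProductWith⁻;
         ∈-cartesianProduct⁺; ∈-cartesianProduct⁻)
open import Data.List.Membership.Propositional.Properties.WithK using (unique∧set⇒bag)
open import Data.List.Relation.Binary.BagAndSetEquality using (∼bag⇒↭)
open import Data.List.Relation.Binary.Permutation.Propositional.Properties using (↭-length)
import Data.List.Relation.Unary.All as ListAll
open import Data.List.Relation.Unary.All.Properties using (all⁺; all⁻)
import Data.List.Relation.Unary.AllPairs as AllPairs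
open import Data.List.Relation.Unary.Any using (here; there)
open import Data.List.Relation.Unary.Unique.Propositional using (Unique)
import Data.List.Relation.Unary.Unique.Propositional.Properties as Unique
open import Data.Nat using (ℕ; zero; suc; _+_; _*_; _^_; _∸_; _≤_; _<_; _⊔_; _<?_; z≤n; s≤s)
open import Data.Nat.ListAction using (sum)
open import Data.Nat.Properties
  using (suc-injective; +-suc; +-identityʳ; *-zeroʳ; *-distribˡ-+; ^-zeroˡ; m+n∸m≡n;
         ≤-refl; ≤-reflexive; ≤-trans; ≤-antisym; ≤-pred; <-irrefl; <-trans; <-≤-trans; ≤∧≢⇒<; ≮⇒≥; 1+n≰n;
         n≤1+n; n<1+n; m<n⇒m<1+n; m≤n⇒m≤1+n; m<1+n⇒m<n∨m≡n; m≤m⊔n; m≤n⊔m; ⊔-lub; <ᵇ⇒<; <⇒<ᵇ; allUpTo?)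
open import Data.Product using (_×_; _,_; proj₁; proj₂; ∃; uncurry; curry)
open import Data.Sum using (inj₁; inj₂)
open import Data.Unit using (tt)
open import Data.Vec as Vec using (Vec; []; _∷_; lookup; insertAt; removeAt; zipWith; replicate; toList)
import Data.Vec.Properties as Vec
open import Data.Vec.Relation.Unary.All as All using (All; []; _∷_)
import Data.Vec.Relation.Unary.All.Properties as All
open import Function using (_∘_; id)
open import Function.Bundles using (_⇔_; mk⇔; Equivalence)
open Equivalence using (to; from)
import Function.Properties.Equivalence as ⇔
open import Function.Definitions using (Injective)
open import Relation.Binary.PropositionalEquality
open import Relation.Nullary using (Dec; ¬_; yes; no)
open import Relation.Nullary.Decidable using (⌊_⌋; map′; _→-dec_; toWitness; fromWitness)

count : {A : Set} → (A → Bool) → List A → ℕ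
count p xs = length (filter (λ x → T? (p x)) xs)

module _ {A : Set} where

  count-cong : {p q : A → Bool} → (∀ x → p x ≡ q x) → ∀ xs → count p xs ≡ count q xs
  count-cong p≗q [] = refl
  count-cong {p} {q} p≗q (x ∷ xs) with p x | q x | p≗q x
  ... | true  | true  | _ = cong suc (count-cong p≗q xs)
  ... | false | false | _ = count-cong p≗q xs

  count-all : {p : A → Bool} → (∀ x → T (p x)) → ∀ xs → count p xs ≡ length xs
  count-all {p} Tp xs = cong length (filter-all (T? ∘ p) (ListAll.universal Tp xs))

  count-none : {p : A → Bool} → (∀ x → ¬ T (p x)) → ∀ xs → count p xs ≡ 0
  count-none {p} ¬Tp xs = cong length (filter-none (T? ∘ p) (ListAll.universal ¬Tp xs))

  count-++ : (p : A → Bool) (xs ys : List A) → count p (xs ++ ys) ≡ count p xs + count p ys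
  count-++ p xs ys = trans (cong length (filter-++ (T? ∘ p) xs ys)) (length-++ (filter (T? ∘ p) xs))

  count-split : (p r : A → Bool) (xs : List A) →
                count p xs ≡ count (λ x → p x ∧ r x) xs + count (λ x → p x ∧ not (r x)) xs
  count-split p r [] = refl
  count-split p r (x ∷ xs) with p x | r x
  ... | false | _     = count-split p r xs
  ... | true  | true  = cong suc (count-split p r xs)
  ... | true  | false = trans (cong suc (count-split p r xs)) (sym (+-suc _ _))

count-map : {A B : Set} (p : B → Bool) (f : A → B) (xs : List A) → count p (List.map f xs) ≡ count (p ∘ f) xs
count-map p f [] = refl
count-map p f (x ∷ xs) with p (f x)
... | true  = cong suc (count-map p f xs)
... | false = count-map p f xs

count-cartesianProductWith :
  {A B C : Set} (f : A → B → C) {r : C → Bool} {p : A → Bool} {q : B → Bool} →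
  (∀ x y → r (f x y) ≡ p x ∧ q y) →
  ∀ xs ys → count r (cartesianProductWith f xs ys) ≡ count p xs * count q ys
count-cartesianProductWith f r≡ [] ys = refl
count-cartesianProductWith f {r} {p} {q} r≡ (x ∷ xs) ys = begin
  count r (List.map (f x) ys ++ cartesianProductWith f xs ys)
    ≡⟨ count-++ r (List.map (f x) ys) _ ⟩
  count r (List.map (f x) ys) + count r (cartesianProductWith f xs ys)
    ≡⟨ cong₂ _+_ (trans (count-map r (f x) ys) (count-cong (r≡ x) ys))
                 (count-cartesianProductWith f r≡ xs ys) ⟩
  count (λ y → p x ∧ q y) ys + count p xs * count q ys
    ≡⟨ row ⟩
  count p (x ∷ xs) * count q ys ∎
  where
  open ≡-Reasoning
  row : count (λ y → p x ∧ q y) ys + count p xs * count q ys ≡ count p (x ∷ xs) * count q ys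
  row with p x
  ... | true  = refl
  ... | false = cong (_+ count p xs * count q ys) (count-none (λ _ ()) ys)

count-bijection :
  {A B : Set} {xs : List A} {ys : List B} (p : A → Bool) (q : B → Bool) →
  Unique xs → Unique ys → (f : A → B) (g : B → A) →
  (∀ {x} → x ∈ xs → T (p x) → f x ∈ ys × T (q (f x)) × g (f x) ≡ x) →
  (∀ {y} → y ∈ ys → T (q y) → g y ∈ xs × T (p (g y)) × f (g y) ≡ y) →
  count p xs ≡ count q ys
count-bijection {xs = xs} {ys} p q xs! ys! f g fwd bwd =
  trans (↭-length (∼bag⇒↭ (unique∧set⇒bag (Unique.filter⁺ P? xs!) image! (mk⇔ into onto))))
        (length-map g (filter Q? ys))
  where
  P? = T? ∘ p
  Q? = T? ∘ q
  fg-filter : List.map f (List.map g (filter Q? ys)) ≡ filter Q? ys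
  fg-filter = trans (sym (List.map-∘ (filter Q? ys))) (map-id-local (ListAll.tabulate fg≡))
    where
    fg≡ : ∀ {y} → y ∈ filter Q? ys → f (g y) ≡ y
    fg≡ y∈ = let y∈ys , qy = ∈-filter⁻ Q? {xs = ys} y∈ in proj₂ (proj₂ (bwd y∈ys qy))
  image! : Unique (List.map g (filter Q? ys))
  image! = Unique.map⁻ {f = f} (subst Unique (sym fg-filter) (Unique.filter⁺ Q? ys!))
  into : ∀ {x} → x ∈ filter P? xs → x ∈ List.map g (filter Q? ys)
  into x∈ with ∈-filter⁻ P? {xs = xs} x∈
  ... | x∈xs , px with fwd x∈xs px
  ... | fx∈ , qfx , gfx≡x = subst (_∈ List.map g (filter Q? ys)) gfx≡x (∈-map⁺ g (∈-filter⁺ Q? fx∈ qfx))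
  onto : ∀ {x} → x ∈ List.map g (filter Q? ys) → x ∈ filter P? xs
  onto x∈ with ∈-map⁻ g x∈
  ... | y , y∈ , refl with ∈-filter⁻ Q? {xs = ys} y∈
  ... | y∈ys , qy with bwd y∈ys qy
  ... | gy∈ , pgy , _ = ∈-filter⁺ P? gy∈ pgy

module _ {A : Set} where

  allVecs-suc : (xs : List A) (k : ℕ) → allVecs xs (suc k) ≡ cartesianProductWith _∷_ xs (allVecs xs k)
  allVecs-suc xs k = go xs
    where
    go : ∀ ys → concatMap (λ x → List.map (x ∷_) (allVecs xs k)) ys ≡ cartesianProductWith _∷_ ys (allVecs xs k)
    go []       = refl
    go (y ∷ ys) = cong (List.map (y ∷_) (allVecs xs k) ++_) (go ys)

  ∈-allVecs⁺ : {xs : List A} {k : ℕ} {v : Vec A k} → All (_∈ xs) v → v ∈ allVecs xs k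
  ∈-allVecs⁺ [] = here refl
  ∈-allVecs⁺ {xs} {suc k} (x∈ ∷ v∈) =
    subst (_ ∈_) (sym (allVecs-suc xs k)) (∈-cartesianProductWith⁺ _∷_ x∈ (∈-allVecs⁺ v∈))

  ∈-allVecs⁻ : {xs : List A} {k : ℕ} {v : Vec A k} → v ∈ allVecs xs k → All (_∈ xs) v
  ∈-allVecs⁻ {v = []} _ = []
  ∈-allVecs⁻ {xs} {suc k} {x ∷ v} x∷v∈
    with ∈-cartesianProductWith⁻ _∷_ xs (allVecs xs k) (subst (_ ∈_) (allVecs-suc xs k) x∷v∈)
  ... | _ , _ , x∈ , v∈ , refl = x∈ ∷ ∈-allVecs⁻ v∈

  allVecs⁺ : {xs : List A} → Unique xs → (k : ℕ) → Unique (allVecs xs k)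
  allVecs⁺ xs! zero    = ListAll.[] AllPairs.∷ AllPairs.[]
  allVecs⁺ {xs} xs! (suc k) =
    subst Unique (sym (allVecs-suc xs k)) (Unique.cartesianProductWith⁺ _∷_ Vec.∷-injective xs! (allVecs⁺ xs! k))

  count-allVecs : (p : A → Bool) (xs : List A) (k : ℕ) →
                  count (λ v → all p (toList v)) (allVecs xs k) ≡ count p xs ^ k
  count-allVecs p xs zero    = refl
  count-allVecs p xs (suc k) = begin
    count (λ v → all p (toList v)) (allVecs xs (suc k))
      ≡⟨ cong (count _) (allVecs-suc xs k) ⟩
    count (λ v → all p (toList v)) (cartesianProductWith _∷_ xs (allVecs xs k))
      ≡⟨ count-cartesianProductWith _∷_ (λ _ _ → refl) xs (allVecs xs k) ⟩
    count p xs * count (λ v → all p (toList v)) (allVecs xs k)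
      ≡⟨ cong (count p xs *_) (count-allVecs p xs k) ⟩
    count p xs ^ suc k ∎
    where open ≡-Reasoning

  length-allVecs : (xs : List A) (k : ℕ) → length (allVecs xs k) ≡ length xs ^ k
  length-allVecs xs k = begin
    length (allVecs xs k)                                     ≡⟨ count-all {p = any-vector} all-true (allVecs xs k) ⟨
    count (λ v → all (λ _ → true) (toList v)) (allVecs xs k)  ≡⟨ count-allVecs (λ _ → true) xs k ⟩
    count (λ _ → true) xs ^ k                                 ≡⟨ cong (_^ k) (count-all {p = λ _ → true} _ xs) ⟩
    length xs ^ k                                             ∎
    where
    open ≡-Reasoning
    any-vector : Vec A k → Bool
    any-vector v = all (λ _ → true) (toList v)
    all-true : ∀ v → T (any-vector v)
    all-true v = all⁻ _ (ListAll.universal _ (toList v))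

clamp : {n : ℕ} → ℕ → Fin (suc n)
clamp {n}     zero    = zero
clamp {zero}  (suc i) = zero
clamp {suc n} (suc i) = suc (clamp i)

toℕ-clamp : {n : ℕ} (i : ℕ) → i ≤ n → toℕ (clamp {n} i) ≡ i
toℕ-clamp zero    _         = refl
toℕ-clamp (suc i) (s≤s i≤n) = cong suc (toℕ-clamp i i≤n)

clamp-toℕ : {n : ℕ} (j : Fin (suc n)) → clamp (toℕ j) ≡ j
clamp-toℕ           zero    = refl
clamp-toℕ {suc n}   (suc j) = cong suc (clamp-toℕ j)

clamp-toℕ-inject₁ : {n : ℕ} (j : Fin (suc n)) → clamp (toℕ (inject₁ j)) ≡ j
clamp-toℕ-inject₁ j = trans (cong clamp (toℕ-inject₁ j)) (clamp-toℕ j)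

inject₁-clamp-toℕ : {n : ℕ} (i : Fin (suc (suc n))) → toℕ i ≤ n → inject₁ (clamp (toℕ i)) ≡ i
inject₁-clamp-toℕ i i≤n = toℕ-injective (trans (toℕ-inject₁ _) (toℕ-clamp (toℕ i) i≤n))

lookup-insertAt-< : {A : Set} {k : ℕ} (xs : Vec A k) (p : Fin (suc k)) (a : A) {i : Fin (suc k)} {j : Fin k} →
                    toℕ i ≡ toℕ j → toℕ i < toℕ p → lookup (insertAt xs p a) i ≡ lookup xs j
lookup-insertAt-< (x ∷ xs) (suc p) a {zero}  {zero}  _  _         = refl
lookup-insertAt-< (x ∷ xs) (suc p) a {suc i} {suc j} eq (s≤s i<p) =
  lookup-insertAt-< xs p a (suc-injective eq) i<p

lookup-insertAt-≢ : {A : Set} {k : ℕ} (xs : Vec A k) (p : Fin (suc k)) (a : A) {i : Fin (suc k)} (p≢i : p ≢ i) →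
                    lookup (insertAt xs p a) i ≡ lookup xs (punchOut p≢i)
lookup-insertAt-≢ xs p a p≢i =
  trans (cong (lookup (insertAt xs p a)) (sym (punchIn-punchOut p≢i))) (Vec.insertAt-punchIn xs p a _)

module _ {n : ℕ} where

  occ-insertAt : {k : ℕ} (i : Fin n) (xs : Vec (Fin n) k) (p : Fin (suc k)) (a : Fin n) →
                 occ i (insertAt xs p a) ≡ occ i (a ∷ xs)
  occ-insertAt i xs       zero    a = refl
  occ-insertAt i (x ∷ xs) (suc p) a =
    trans (cong (δ x +_) (occ-insertAt i xs p a)) (x∙yz≈y∙xz (δ x) (δ a) (occ i xs))
    where
    δ : Fin n → ℕ
    δ y = if ⌊ y ≟ i ⌋ then 1 else 0

  occ-removeAt : {k : ℕ} (i : Fin n) (v : Vec (Fin n) (suc k)) (p : Fin (suc k)) →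
                 occ i v ≡ occ i (lookup v p ∷ removeAt v p)
  occ-removeAt i v p =
    trans (cong (occ i) (sym (Vec.insertAt-removeAt v p))) (occ-insertAt i (removeAt v p) p (lookup v p))

  occ-∷-self : {k : ℕ} (i : Fin n) (w : Vec (Fin n) k) → occ i (i ∷ w) ≡ suc (occ i w)
  occ-∷-self i w with i ≟ i
  ... | yes _ = refl
  ... | no i≢i = ⊥-elim (i≢i refl)

  occ≡suc⇒lookup : {k c : ℕ} (i : Fin n) (v : Vec (Fin n) k) → occ i v ≡ suc c → ∃ λ j → lookup v j ≡ i
  occ≡suc⇒lookup i (x ∷ v) eq with x ≟ i
  ... | yes x≡i = zero , x≡i
  ... | no _    = let j , eq′ = occ≡suc⇒lookup i v eq in suc j , eq′

module _ {a b : ℕ} {f : Fin a → Fin b} where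

  occ-map-injective : Injective _≡_ _≡_ f → {k : ℕ} (i : Fin a) (v : Vec (Fin a) k) → occ (f i) (Vec.map f v) ≡ occ i v
  occ-map-injective f-inj i []      = refl
  occ-map-injective f-inj i (x ∷ v) = cong₂ _+_ (cong (λ b → if b then 1 else 0) same) (occ-map-injective f-inj i v)
    where
    same : ⌊ f x ≟ f i ⌋ ≡ ⌊ x ≟ i ⌋
    same with x ≟ i | f x ≟ f i
    ... | yes _   | yes _     = refl
    ... | no _    | no _      = refl
    ... | yes x≡i | no fx≢fi  = ⊥-elim (fx≢fi (cong f x≡i))
    ... | no x≢i  | yes fx≡fi = ⊥-elim (x≢i (f-inj fx≡fi))

  occ-map-∉ : {k : ℕ} (i : Fin b) → (∀ x → f x ≢ i) → (v : Vec (Fin a) k) → occ i (Vec.map f v) ≡ 0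
  occ-map-∉ i f≢i []      = refl
  occ-map-∉ i f≢i (x ∷ v) with f x ≟ i
  ... | yes fx≡i = ⊥-elim (f≢i x fx≡i)
  ... | no _     = occ-map-∉ i f≢i v

IsPermutation : {n : ℕ} → Vec (Fin n) n → Set
IsPermutation v = ∀ i → occ i v ≡ 1

module _ {n : ℕ} {v : Vec (Fin n) n} where

  ∈-S⁺ : IsPermutation v → v ∈ S n
  ∈-S⁺ perm = ∈-filter⁺ (T? ∘ isPerm) (∈-allVecs⁺ (All.universal ∈-allFin v))
                        (all⁻ _ (ListAll.universal (λ i → fromWitness (perm i)) (allFin n)))

  ∈-S⁻ : v ∈ S n → IsPermutation v
  ∈-S⁻ v∈ i = toWitness (ListAll.lookup (all⁺ _ (allFin n) isPerm-v) (∈-allFin i))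
    where isPerm-v = proj₂ (∈-filter⁻ (T? ∘ isPerm) {xs = allVecs (allFin n) n} v∈)

S-unique : (n : ℕ) → Unique (S n)
S-unique n = Unique.filter⁺ (T? ∘ isPerm) (allVecs⁺ (Unique.allFin⁺ n) n)

module _ {n : ℕ} where

  top : Fin (suc (suc n))
  top = fromℕ (suc n)

  ≢top⇒toℕ≤n : (i : Fin (suc (suc n))) → i ≢ top → toℕ i ≤ n
  ≢top⇒toℕ≤n i i≢top =
    ≤-pred (≤∧≢⇒< (≤-pred (toℕ<n i)) (λ eq → i≢top (toℕ-injective (trans eq (sym (toℕ-fromℕ (suc n)))))))

  insertTop : Fin (suc (suc n)) → Vec (Fin (suc n)) (suc n) → Vec (Fin (suc (suc n))) (suc (suc n))
  insertTop p v = insertAt (Vec.map inject₁ v) p top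

  -- Entries equal to top other than at p are clamped to fromℕ n; removeTop is only used when top sits at p.
  removeTop : Fin (suc (suc n)) → Vec (Fin (suc (suc n))) (suc (suc n)) → Vec (Fin (suc n)) (suc n)
  removeTop p v = Vec.map (clamp ∘ toℕ) (removeAt v p)

  removeTop-insertTop : (p : Fin (suc (suc n))) (v : Vec (Fin (suc n)) (suc n)) → removeTop p (insertTop p v) ≡ v
  removeTop-insertTop p v = begin
    Vec.map (clamp ∘ toℕ) (removeAt (insertTop p v) p)  ≡⟨ cong (Vec.map _) (Vec.removeAt-insertAt _ p top) ⟩
    Vec.map (clamp ∘ toℕ) (Vec.map inject₁ v)           ≡⟨ Vec.map-∘ _ inject₁ v ⟨
    Vec.map (clamp ∘ toℕ ∘ inject₁) v                   ≡⟨ Vec.map-cong clamp-toℕ-inject₁ v ⟩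
    Vec.map id v                                        ≡⟨ Vec.map-id v ⟩
    v                                                   ∎
    where open ≡-Reasoning

  map-inject₁-clamp : {k : ℕ} (w : Vec (Fin (suc (suc n))) k) → occ top w ≡ 0 →
                      Vec.map (inject₁ ∘ clamp ∘ toℕ) w ≡ w
  map-inject₁-clamp []      _     = refl
  map-inject₁-clamp (x ∷ w) no-top with x ≟ top
  ... | no x≢top = cong₂ _∷_ (inject₁-clamp-toℕ x (≢top⇒toℕ≤n x x≢top)) (map-inject₁-clamp w no-top)

  occ-insertTop-top : (p : Fin (suc (suc n))) (v : Vec (Fin (suc n)) (suc n)) → occ top (insertTop p v) ≡ 1
  occ-insertTop-top p v = begin
    occ top (insertTop p v)            ≡⟨ occ-insertAt top (Vec.map inject₁ v) p top ⟩
    occ top (top ∷ Vec.map inject₁ v)  ≡⟨ occ-∷-self top (Vec.map inject₁ v) ⟩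
    suc (occ top (Vec.map inject₁ v))  ≡⟨ cong suc (occ-map-∉ top (λ x → fromℕ≢inject₁ ∘ sym) v) ⟩
    1                                  ∎
    where open ≡-Reasoning

  occ-insertTop-inject₁ : (p : Fin (suc (suc n))) (v : Vec (Fin (suc n)) (suc n)) (j : Fin (suc n)) →
                          occ (inject₁ j) (insertTop p v) ≡ occ j v
  occ-insertTop-inject₁ p v j rewrite occ-insertAt (inject₁ j) (Vec.map inject₁ v) p top with top ≟ inject₁ j
  ... | yes top≡j = ⊥-elim (fromℕ≢inject₁ top≡j)
  ... | no _      = occ-map-injective inject₁-injective j v

  module _ {p : Fin (suc (suc n))} where

    insertTop-isPerm : {v : Vec (Fin (suc n)) (suc n)} → IsPermutation v → IsPermutation (insertTop p v)
    insertTop-isPerm {v} perm i with i ≟ top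
    ... | yes refl = occ-insertTop-top p v
    ... | no i≢top = subst (λ i → occ i (insertTop p v) ≡ 1) (inject₁-clamp-toℕ i (≢top⇒toℕ≤n i i≢top))
                           (trans (occ-insertTop-inject₁ p v _) (perm _))

    module _ {v : Vec (Fin (suc (suc n))) (suc (suc n))} (perm : IsPermutation v) (top-at-p : lookup v p ≡ top) where

      insertTop-removeTop : insertTop p (removeTop p v) ≡ v
      insertTop-removeTop = begin
        insertAt (Vec.map inject₁ (Vec.map (clamp ∘ toℕ) w)) p top  ≡⟨ cong (λ u → insertAt u p top) (Vec.map-∘ _ _ w) ⟨
        insertAt (Vec.map (inject₁ ∘ clamp ∘ toℕ) w) p top
          ≡⟨ cong (λ u → insertAt u p top) (map-inject₁-clamp w no-top) ⟩
        insertAt w p top                                            ≡⟨ cong (insertAt w p) top-at-p ⟨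
        insertAt w p (lookup v p)                                   ≡⟨ Vec.insertAt-removeAt v p ⟩
        v                                                           ∎
        where
        open ≡-Reasoning
        w = removeAt v p
        no-top : occ top w ≡ 0
        no-top = suc-injective (begin
          suc (occ top w)           ≡⟨ occ-∷-self top w ⟨
          occ top (top ∷ w)         ≡⟨ cong (λ x → occ top (x ∷ w)) top-at-p ⟨
          occ top (lookup v p ∷ w)  ≡⟨ occ-removeAt top v p ⟨
          occ top v                 ≡⟨ perm top ⟩
          1                         ∎)

      removeTop-isPerm : IsPermutation (removeTop p v)
      removeTop-isPerm j = begin
        occ j (removeTop p v)                           ≡⟨ occ-insertTop-inject₁ p _ j ⟨
        occ (inject₁ j) (insertTop p (removeTop p v))   ≡⟨ cong (occ (inject₁ j)) insertTop-removeTop ⟩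
        occ (inject₁ j) v                               ≡⟨ perm (inject₁ j) ⟩
        1                                               ∎
        where open ≡-Reasoning

  toℕ-lookup-insertTop-< : (p : Fin (suc (suc n))) (v : Vec (Fin (suc n)) (suc n)) {i : ℕ} → i < toℕ p →
                           toℕ (lookup (insertTop p v) (clamp i)) ≡ toℕ (lookup v (clamp i))
  toℕ-lookup-insertTop-< p v {i} i<p = begin
    toℕ (lookup (insertTop p v) (clamp i))
      ≡⟨ cong toℕ (lookup-insertAt-< (Vec.map inject₁ v) p top same-index i′<p) ⟩
    toℕ (lookup (Vec.map inject₁ v) (clamp i))  ≡⟨ cong toℕ (Vec.lookup-map (clamp i) inject₁ v) ⟩
    toℕ (inject₁ (lookup v (clamp i)))          ≡⟨ toℕ-inject₁ _ ⟩
    toℕ (lookup v (clamp i))                    ∎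
    where
    open ≡-Reasoning
    i≤n : i ≤ n
    i≤n = ≤-pred (≤-trans i<p (≤-pred (toℕ<n p)))
    same-index : toℕ (clamp {suc n} i) ≡ toℕ (clamp {n} i)
    same-index = trans (toℕ-clamp i (m≤n⇒m≤1+n i≤n)) (sym (toℕ-clamp i i≤n))
    i′<p : toℕ (clamp {suc n} i) < toℕ p
    i′<p = subst (_< toℕ p) (sym (toℕ-clamp i (m≤n⇒m≤1+n i≤n))) i<p

  toℕ-lookup-insertTop-≢ : (p : Fin (suc (suc n))) (v : Vec (Fin (suc n)) (suc n)) {j : Fin (suc (suc n))} → p ≢ j →
                           toℕ (lookup (insertTop p v) j) ≤ n
  toℕ-lookup-insertTop-≢ p v p≢j = subst (_≤ n) (sym entry) (≤-pred (toℕ<n _))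
    where
    entry : toℕ (lookup (insertTop p v) _) ≡ toℕ (lookup v (punchOut p≢j))
    entry = trans (cong toℕ (trans (lookup-insertAt-≢ (Vec.map inject₁ v) p top p≢j) (Vec.lookup-map _ inject₁ v)))
                  (toℕ-inject₁ _)

Tuple : ℕ → ℕ → Set
Tuple m n = Vec (Vec (Fin n) n) m

lookup≤lev : {m n : ℕ} (Π : Tuple m n) (j : Fin n) (k : Fin m) → toℕ (lookup (lookup Π k) j) ≤ lev Π j
lookup≤lev (π ∷ Π) j zero    = m≤m⊔n _ _
lookup≤lev (π ∷ Π) j (suc k) = ≤-trans (lookup≤lev Π j k) (m≤n⊔m _ _)

lev≤ : {m n : ℕ} (Π : Tuple m n) (j : Fin n) {b : ℕ} → (∀ k → toℕ (lookup (lookup Π k) j) ≤ b) → lev Π j ≤ b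
lev≤ []      j bound = z≤n
lev≤ (π ∷ Π) j bound = ⊔-lub (bound zero) (lev≤ Π j (bound ∘ suc))

lev-cong : {m a b : ℕ} (Π₁ : Tuple m a) (Π₂ : Tuple m b) {j₁ : Fin a} {j₂ : Fin b} →
           (∀ k → toℕ (lookup (lookup Π₁ k) j₁) ≡ toℕ (lookup (lookup Π₂ k) j₂)) → lev Π₁ j₁ ≡ lev Π₂ j₂
lev-cong []        []        same = refl
lev-cong (π₁ ∷ Π₁) (π₂ ∷ Π₂) same = cong₂ _⊔_ (same zero) (lev-cong Π₁ Π₂ (same ∘ suc))

-- Columns are indexed by ℕ; since clamp saturates, indices past the last column read the last column.
level : {m n : ℕ} → Tuple m (suc n) → ℕ → ℕ
level Π i = lev Π (clamp i)

level≤ : {m n : ℕ} (Π : Tuple m (suc n)) (i : ℕ) → level Π i ≤ n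
level≤ Π i = lev≤ Π (clamp i) (λ k → ≤-pred (toℕ<n _))

tabulate≡applyUpTo : {A : Set} {N : ℕ} (f : Fin N → A) (g : ℕ → A) → (∀ j → f j ≡ g (toℕ j)) →
                     List.tabulate f ≡ applyUpTo g N
tabulate≡applyUpTo {N = zero}  f g f≗g = refl
tabulate≡applyUpTo {N = suc N} f g f≗g =
  cong₂ List._∷_ (f≗g zero) (tabulate≡applyUpTo (f ∘ suc) (g ∘ suc) (f≗g ∘ suc))

levels≡applyUpTo : {m n : ℕ} (Π : Tuple m (suc n)) → levels Π ≡ applyUpTo (level Π) (suc n)
levels≡applyUpTo Π =
  trans (List.map-tabulate id (lev Π)) (tabulate≡applyUpTo (lev Π) (level Π) (λ j → cong (lev Π) (sym (clamp-toℕ j))))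

module _ {m n : ℕ} where

  AllPerms : Tuple m n → Set
  AllPerms = All IsPermutation

  ∈-Sd⁺ : {Π : Tuple m n} → AllPerms Π → Π ∈ Sd n (suc m)
  ∈-Sd⁺ perms = ∈-allVecs⁺ (All.map ∈-S⁺ perms)

  ∈-Sd⁻ : {Π : Tuple m n} → Π ∈ Sd n (suc m) → AllPerms Π
  ∈-Sd⁻ Π∈ = All.map ∈-S⁻ (∈-allVecs⁻ Π∈)

  Sd-unique : Unique (Sd n (suc m))
  Sd-unique = allVecs⁺ (S-unique n) m

TopsAt : {m n : ℕ} → Vec (Fin (suc (suc n))) m → Tuple m (suc (suc n)) → Set
TopsAt ps Π = ∀ k → lookup (lookup Π k) (lookup ps k) ≡ top

insertTops : {m n : ℕ} → Vec (Fin (suc (suc n))) m → Tuple m (suc n) → Tuple m (suc (suc n))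
insertTops = zipWith insertTop

removeTops : {m n : ℕ} → Vec (Fin (suc (suc n))) m → Tuple m (suc (suc n)) → Tuple m (suc n)
removeTops = zipWith removeTop

removeTops-insertTops : {m n : ℕ} (ps : Vec (Fin (suc (suc n))) m) (Π′ : Tuple m (suc n)) →
                        removeTops ps (insertTops ps Π′) ≡ Π′
removeTops-insertTops []       []       = refl
removeTops-insertTops (p ∷ ps) (π ∷ Π′) = cong₂ _∷_ (removeTop-insertTop p π) (removeTops-insertTops ps Π′)

insertTops-removeTops : {m n : ℕ} {ps : Vec (Fin (suc (suc n))) m} {Π : Tuple m (suc (suc n))} →
                        AllPerms Π → TopsAt ps Π → insertTops ps (removeTops ps Π) ≡ Π
insertTops-removeTops {ps = []}    []             tops = refl
insertTops-removeTops {ps = p ∷ _} {π ∷ _} (perm ∷ perms) tops =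
  cong₂ _∷_ (insertTop-removeTop {p = p} {π} perm (tops zero)) (insertTops-removeTops perms (tops ∘ suc))

insertTops-allPerms : {m n : ℕ} (ps : Vec (Fin (suc (suc n))) m) {Π′ : Tuple m (suc n)} →
                      AllPerms Π′ → AllPerms (insertTops ps Π′)
insertTops-allPerms []       []             = []
insertTops-allPerms (p ∷ ps) {π ∷ _} (perm ∷ perms) =
  insertTop-isPerm {p = p} {π} perm ∷ insertTops-allPerms ps perms

removeTops-allPerms : {m n : ℕ} {ps : Vec (Fin (suc (suc n))) m} {Π : Tuple m (suc (suc n))} →
                      AllPerms Π → TopsAt ps Π → AllPerms (removeTops ps Π)
removeTops-allPerms {ps = []}    []             tops = []
removeTops-allPerms {ps = p ∷ _} {π ∷ _} (perm ∷ perms) tops =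
  removeTop-isPerm {p = p} {π} perm (tops zero) ∷ removeTops-allPerms perms (tops ∘ suc)

module _ {m n : ℕ} (ps : Vec (Fin (suc (suc n))) m) (Π′ : Tuple m (suc n)) where

  private
    column : (i : ℕ) (k : Fin m) → toℕ (lookup (lookup (insertTops ps Π′) k) (clamp i))
                                  ≡ toℕ (lookup (insertTop (lookup ps k) (lookup Π′ k)) (clamp i))
    column i k = cong (λ π → toℕ (lookup π (clamp i))) (Vec.lookup-zipWith insertTop k ps Π′)

  level-insertTops-< : {i : ℕ} → (∀ k → i < toℕ (lookup ps k)) → level (insertTops ps Π′) i ≡ level Π′ i
  level-insertTops-< {i} i<ps =
    lev-cong (insertTops ps Π′) Π′ (λ k → trans (column i k) (toℕ-lookup-insertTop-< _ (lookup Π′ k) (i<ps k)))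

  level-insertTops-top : {i : ℕ} (k : Fin m) → lookup ps k ≡ clamp i → suc n ≤ level (insertTops ps Π′) i
  level-insertTops-top {i} k p≡i =
    subst (_≤ level (insertTops ps Π′) i) top-entry (lookup≤lev (insertTops ps Π′) (clamp i) k)
    where
    top-entry : toℕ (lookup (lookup (insertTops ps Π′) k) (clamp i)) ≡ suc n
    top-entry = trans (column i k) (trans (cong toℕ (trans (cong (lookup π) (sym p≡i))
                                                           (Vec.insertAt-lookup _ (lookup ps k) top)))
                                          (toℕ-fromℕ (suc n)))
      where π = insertTop (lookup ps k) (lookup Π′ k)

  level-insertTops-≢ : {i : ℕ} → (∀ k → lookup ps k ≢ clamp i) → level (insertTops ps Π′) i ≤ n
  level-insertTops-≢ {i} ps≢i =
    lev≤ (insertTops ps Π′) (clamp i) (λ k → subst (_≤ n) (sym (column i k)) (toℕ-lookup-insertTop-≢ _ _ (ps≢i k)))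

top≤level : {m n : ℕ} (Π : Tuple m (suc (suc n))) (k : Fin m) {c : Fin (suc (suc n))} →
            lookup (lookup Π k) c ≡ top → suc n ≤ level Π (toℕ c)
top≤level {n = n} Π k {c} top-at-c =
  subst₂ _≤_ (trans (cong toℕ top-at-c) (toℕ-fromℕ (suc n))) (cong (lev Π) (sym (clamp-toℕ c))) (lookup≤lev Π c k)

Increasing : (ℕ → ℕ) → ℕ → Set
Increasing g M = ∀ {k} → suc k < M → g k < g (suc k)

-- allUpTo? quantifies over k < M, so the guard suc k < M is added to drop k = M − 1.
increasing? : (g : ℕ → ℕ) (M : ℕ) → Dec (Increasing g M)
increasing? g M = map′ unguard guard (allUpTo? (λ k → suc k <? M →-dec g k <? g (suc k)) M)
  where
  Guarded = ∀ {k} → k < M → suc k < M → g k < g (suc k)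
  unguard : Guarded → Increasing g M
  unguard h {k} sk<M = h (<-trans (n<1+n k) sk<M) sk<M
  guard : Increasing g M → Guarded
  guard h _ sk<M = h sk<M

Increasing-cong : {f g : ℕ → ℕ} {M : ℕ} → (∀ {i} → i < M → f i ≡ g i) → Increasing f M → Increasing g M
Increasing-cong f≡g inc {k} sk<M = subst₂ _<_ (f≡g (<-trans (n<1+n k) sk<M)) (f≡g sk<M) (inc sk<M)

Increasing-∷ : {g : ℕ → ℕ} {M : ℕ} → Increasing g (suc (suc M)) ⇔ (g 0 < g 1 × Increasing (g ∘ suc) (suc M))
Increasing-∷ = mk⇔ (λ inc → inc (s≤s (s≤s z≤n)) , (λ {k} sk<M → inc {suc k} (s≤s sk<M)))
                   (λ { (g0<g1 , inc) {zero} _ → g0<g1 ; (g0<g1 , inc) {suc k} (s≤s sk<M) → inc sk<M })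

Increasing-top : {f g : ℕ → ℕ} {j : ℕ} → (∀ {i} → i < j → f i ≡ g i) → (∀ {i} → i < j → g i < f j) →
                 Increasing f (suc j) ⇔ Increasing g j
Increasing-top {f} {g} {j} f≡g below-top = mk⇔ restrict extend
  where
  restrict : Increasing f (suc j) → Increasing g j
  restrict inc = Increasing-cong f≡g (λ sk<j → inc (m<n⇒m<1+n sk<j))
  extend : Increasing g j → Increasing f (suc j)
  extend inc {k} sk<1+j with m<1+n⇒m<n∨m≡n sk<1+j
  ... | inj₁ sk<j = subst₂ _<_ (sym (f≡g (<-trans (n<1+n k) sk<j))) (sym (f≡g sk<j)) (inc sk<j)
  ... | inj₂ refl = subst (_< f j) (sym (f≡g (n<1+n k))) (below-top (n<1+n k))

Increasing⇒≤ : {g : ℕ → ℕ} {j t c : ℕ} → Increasing g (suc j) → (∀ i → g i ≤ t) → t ≤ g c → j ≤ c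
Increasing⇒≤ {g} inc ≤t t≤gc = ≮⇒≥ (λ c<j → <-irrefl refl (<-≤-trans (inc (s≤s c<j)) (≤-trans (≤t _) t≤gc)))

hoeList-applyUpTo : (g : ℕ → ℕ) (n : ℕ) →
                    T (hoeList (applyUpTo g (suc (suc n)))) ⇔ (Increasing g (suc n) × g (suc n) < g n)
hoeList-applyUpTo g zero    = mk⇔ (λ t → (λ { (s≤s ()) }) , <ᵇ⇒< _ _ t) (λ (_ , g1<g0) → <⇒<ᵇ g1<g0)
hoeList-applyUpTo g (suc n) = mk⇔ forward backward
  where
  rest = hoeList-applyUpTo (g ∘ suc) n
  forward : T (hoeList (applyUpTo g (3 + n))) → Increasing g (2 + n) × g (2 + n) < g (1 + n)
  forward t = let g0<ᵇg1 , t′ = to T-∧ t ; inc , last = to rest t′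
              in  from (Increasing-∷ {g}) (<ᵇ⇒< _ _ g0<ᵇg1 , inc) , last
  backward : Increasing g (2 + n) × g (2 + n) < g (1 + n) → T (hoeList (applyUpTo g (3 + n)))
  backward (inc , last) = let g0<g1 , inc′ = to (Increasing-∷ {g}) inc
                          in  from T-∧ (<⇒<ᵇ g0<g1 , from rest (inc′ , last))

module _ {m n : ℕ} (ps : Vec (Fin (suc (suc n))) m) (Π′ : Tuple m (suc n)) {j : ℕ}
         (j≤ps : ∀ k → j ≤ toℕ (lookup ps k)) where

  private
    unchanged : ∀ {i} → i < j → level (insertTops ps Π′) i ≡ level Π′ i
    unchanged i<j = level-insertTops-< ps Π′ (λ k → <-≤-trans i<j (j≤ps k))

  rising-insertTops-above : Increasing (level (insertTops ps Π′)) j ⇔ Increasing (level Π′) j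
  rising-insertTops-above = mk⇔ (Increasing-cong unchanged) (Increasing-cong (sym ∘ unchanged))

  rising-insertTops-at : (k : Fin m) → lookup ps k ≡ clamp j →
                         Increasing (level (insertTops ps Π′)) (suc j) ⇔ Increasing (level Π′) j
  rising-insertTops-at k ps≡j =
    Increasing-top unchanged (λ {i} _ → ≤-trans (s≤s (level≤ Π′ i)) (level-insertTops-top ps Π′ k ps≡j))

top-position-≥ : {m n j : ℕ} {Π : Tuple m (suc (suc n))} → AllPerms Π → Increasing (level Π) (suc j) →
                 (k : Fin m) → ∃ λ c → lookup (lookup Π k) c ≡ top × j ≤ toℕ c
top-position-≥ {Π = Π} perms rising k =
  let c , c-top = occ≡suc⇒lookup top (lookup Π k) (All.lookup⁺ perms k top)
  in  c , c-top , Increasing⇒≤ rising (level≤ Π) (top≤level Π k c-top)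

count-insertTops :
  {m n : ℕ} {B : Set} {tags : List B} → Unique tags →
  (positions : B → Vec (Fin (suc (suc n))) m) (tag : Tuple m (suc (suc n)) → B) →
  (∀ Π → tag Π ∈ tags) → (∀ b Π′ → tag (insertTops (positions b) Π′) ≡ b) →
  (p : Tuple m (suc (suc n)) → Bool) (q : B → Tuple m (suc n) → Bool) →
  (∀ {Π} → AllPerms Π → T (p Π) → TopsAt (positions (tag Π)) Π) →
  (∀ b {Π′} → AllPerms Π′ → T (p (insertTops (positions b) Π′)) ⇔ T (q b Π′)) →
  count p (Sd (suc (suc n)) (suc m)) ≡ count (uncurry q) (cartesianProduct tags (Sd (suc n) (suc m)))
count-insertTops {m} {n} {B} {tags} tags! positions tag tag∈ tag-insertTops p q tops p⇔q =
  count-bijection p (uncurry q) Sd-unique (Unique.cartesianProduct⁺ tags! Sd-unique) split join fwd bwd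
  where
  split : Tuple m (suc (suc n)) → B × Tuple m (suc n)
  split Π = tag Π , removeTops (positions (tag Π)) Π

  join : B × Tuple m (suc n) → Tuple m (suc (suc n))
  join (b , Π′) = insertTops (positions b) Π′

  split-join : ∀ b Π′ → split (join (b , Π′)) ≡ (b , Π′)
  split-join b Π′ rewrite tag-insertTops b Π′ = cong (b ,_) (removeTops-insertTops (positions b) Π′)

  fwd : ∀ {Π} → Π ∈ Sd (suc (suc n)) (suc m) → T (p Π) →
        split Π ∈ cartesianProduct tags (Sd (suc n) (suc m)) × T (uncurry q (split Π)) × join (split Π) ≡ Π
  fwd {Π} Π∈ pΠ = ∈-cartesianProduct⁺ (tag∈ Π) (∈-Sd⁺ perms′) , to (p⇔q (tag Π) perms′) p-join , joined
    where
    perms = ∈-Sd⁻ Π∈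
    perms′ = removeTops-allPerms perms (tops perms pΠ)
    joined = insertTops-removeTops perms (tops perms pΠ)
    p-join = subst (T ∘ p) (sym joined) pΠ

  bwd : ∀ {y} → y ∈ cartesianProduct tags (Sd (suc n) (suc m)) → T (uncurry q y) →
        join y ∈ Sd (suc (suc n)) (suc m) × T (p (join y)) × split (join y) ≡ y
  bwd {b , Π′} y∈ qy = ∈-Sd⁺ (insertTops-allPerms (positions b) perms′) , from (p⇔q b perms′) qy , split-join b Π′
    where perms′ = ∈-Sd⁻ (proj₂ (∈-cartesianProduct⁻ tags _ y∈))

count-insertTops-at :
  {m n : ℕ} (ps : Vec (Fin (suc (suc n))) m) (p : Tuple m (suc (suc n)) → Bool) (q : Tuple m (suc n) → Bool) →
  (∀ {Π} → AllPerms Π → T (p Π) → TopsAt ps Π) →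
  (∀ {Π′} → AllPerms Π′ → T (p (insertTops ps Π′)) ⇔ T (q Π′)) →
  count p (Sd (suc (suc n)) (suc m)) ≡ count q (Sd (suc n) (suc m))
count-insertTops-at {m} {n} ps p q tops p⇔q = begin
  count p (Sd (suc (suc n)) (suc m))
    ≡⟨ count-insertTops unique-tt (λ _ → ps) (λ _ → tt) (λ _ → here refl) (λ _ _ → refl)
                        p (λ _ → q) tops (λ _ → p⇔q) ⟩
  count (q ∘ proj₂) (cartesianProduct (tt ∷ []) (Sd (suc n) (suc m)))
    ≡⟨ count-cartesianProductWith _,_ {p = λ _ → true} {q} (λ _ _ → refl) (tt ∷ []) (Sd (suc n) (suc m)) ⟩
  1 * count q (Sd (suc n) (suc m))
    ≡⟨ +-identityʳ _ ⟩
  count q (Sd (suc n) (suc m)) ∎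
  where
  open ≡-Reasoning
  unique-tt : Unique (tt ∷ [])
  unique-tt = ListAll.[] AllPairs.∷ AllPairs.[]

isRisingOn : {m n : ℕ} → ℕ → Tuple m (suc n) → Bool
isRisingOn M Π = ⌊ increasing? (level Π) M ⌋

isRising isRisingButLast : {m n : ℕ} → Tuple m (suc n) → Bool
isRising        {n = n} = isRisingOn (suc n)
isRisingButLast {n = n} = isRisingOn n

T-isRisingOn : {m n M : ℕ} {Π : Tuple m (suc n)} → T (isRisingOn M Π) ⇔ Increasing (level Π) M
T-isRisingOn = mk⇔ toWitness fromWitness

isRisingOn⇔ : {m a b M N : ℕ} (Π : Tuple m (suc a)) (Π′ : Tuple m (suc b)) →
              Increasing (level Π) M ⇔ Increasing (level Π′) N → T (isRisingOn M Π) ⇔ T (isRisingOn N Π′)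
isRisingOn⇔ Π Π′ rising⇔ = ⇔.trans (T-isRisingOn {Π = Π}) (⇔.trans rising⇔ (⇔.sym (T-isRisingOn {Π = Π′})))

isHoe⇔ : {m n : ℕ} (Π : Tuple m (suc (suc n))) →
         T (isHoe Π) ⇔ (Increasing (level Π) (suc n) × level Π (suc n) < level Π n)
isHoe⇔ {n = n} Π = subst (λ ls → T (hoeList ls) ⇔ HoeLevels) (sym (levels≡applyUpTo Π)) (hoeList-applyUpTo (level Π) n)
  where HoeLevels = Increasing (level Π) (suc n) × level Π (suc n) < level Π n

module _ {n : ℕ} where

  penultimate last : Fin (suc (suc n))
  penultimate = clamp n
  last        = clamp (suc n)

  toℕ-penultimate : toℕ penultimate ≡ n
  toℕ-penultimate = toℕ-clamp n (n≤1+n n)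

  toℕ-last : toℕ last ≡ suc n
  toℕ-last = toℕ-clamp (suc n) ≤-refl

  penultimate≢last : penultimate ≢ last
  penultimate≢last eq = <-irrefl (trans (sym toℕ-penultimate) (trans (cong toℕ eq) toℕ-last)) (n<1+n n)

  toℕ≡last : (c : Fin (suc (suc n))) → suc n ≤ toℕ c → toℕ c ≡ suc n
  toℕ≡last c n<c = ≤-antisym (≤-pred (toℕ<n c)) n<c

  toℕ≡penultimate : (c : Fin (suc (suc n))) → n ≤ toℕ c → toℕ c ≢ suc n → toℕ c ≡ n
  toℕ≡penultimate c n≤c c≢last = ≤-antisym (≤-pred (≤∧≢⇒< (≤-pred (toℕ<n c)) c≢last)) n≤c

  top-at : {π : Vec (Fin (suc (suc n))) (suc (suc n))} {c p : Fin (suc (suc n))} {i : ℕ} →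
           lookup π c ≡ top → toℕ c ≡ i → p ≡ clamp i → lookup π p ≡ top
  top-at {π} {c} c-top refl refl = subst (λ j → lookup π j ≡ top) (sym (clamp-toℕ c)) c-top

count-Sd-1 : {m : ℕ} (p : Tuple m 1 → Bool) → (∀ Π → T (p Π)) → count p (Sd 1 (suc m)) ≡ 1
count-Sd-1 {m} p Tp = trans (count-all Tp (Sd 1 (suc m))) (trans (length-allVecs (S 1) m) (^-zeroˡ m))

module _ {m n : ℕ} where

  count-hoe : count isHoe (Sd (suc (suc n)) (suc (suc m))) ≡ count isRisingButLast (Sd (suc n) (suc (suc m)))
  count-hoe = count-insertTops-at ps isHoe isRisingButLast tops transfer
    where
    ps = replicate (suc m) (penultimate {n})

    ps≡penultimate : ∀ k → lookup ps k ≡ penultimate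
    ps≡penultimate k = Vec.lookup-replicate k penultimate

    -- The maximum is not before the peak n since levels rise up to n, nor after it since the last level is lower.
    tops : ∀ {Π} → AllPerms Π → T (isHoe Π) → TopsAt ps Π
    tops {Π} perms hoe k with to (isHoe⇔ Π) hoe
    ... | rising , descent with top-position-≥ perms rising k
    ... | c , c-top , n≤c = top-at {π = lookup Π k} c-top (toℕ≡penultimate c n≤c c≢last) (ps≡penultimate k)
      where
      c≢last : toℕ c ≢ suc n
      c≢last c≡last = <-irrefl refl (<-≤-trans descent (≤-trans (level≤ Π n) top≤last))
        where top≤last = subst (λ i → suc n ≤ level Π i) c≡last (top≤level Π k c-top)

    transfer : ∀ {Π′} → AllPerms Π′ → T (isHoe (insertTops ps Π′)) ⇔ T (isRisingButLast Π′)
    transfer {Π′} _ = ⇔.trans (isHoe⇔ Π) (⇔.trans always-descends (⇔.trans rising⇔ (⇔.sym (T-isRisingOn {Π = Π′}))))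
      where
      Π = insertTops ps Π′
      descends : level Π (suc n) < level Π n
      descends = ≤-trans (s≤s (level-insertTops-≢ ps Π′ (λ k → penultimate≢last ∘ trans (sym (ps≡penultimate k)))))
                         (level-insertTops-top ps Π′ zero refl)
      always-descends : (Increasing (level Π) (suc n) × level Π (suc n) < level Π n) ⇔ Increasing (level Π) (suc n)
      always-descends = mk⇔ proj₁ (_, descends)
      rising⇔ = rising-insertTops-at ps Π′ ps≥n zero refl
        where
        ps≥n : ∀ k → n ≤ toℕ (lookup ps k)
        ps≥n k = ≤-reflexive (sym (trans (cong toℕ (ps≡penultimate k)) toℕ-penultimate))

module _ {m : ℕ} where

  count-rising-suc : {n : ℕ} → count isRising (Sd (suc (suc n)) (suc (suc m))) ≡ count isRising (Sd (suc n) (suc (suc m)))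
  count-rising-suc {n} = count-insertTops-at ps isRising isRising tops transfer
    where
    ps = replicate (suc m) (last {n})

    ps≡last : ∀ k → lookup ps k ≡ last
    ps≡last k = Vec.lookup-replicate k last

    tops : ∀ {Π} → AllPerms Π → T (isRising Π) → TopsAt ps Π
    tops {Π} perms rising k with top-position-≥ perms (to (T-isRisingOn {Π = Π}) rising) k
    ... | c , c-top , n<c = top-at {π = lookup Π k} c-top (toℕ≡last c n<c) (ps≡last k)

    transfer : ∀ {Π′} → AllPerms Π′ → T (isRising (insertTops ps Π′)) ⇔ T (isRising Π′)
    transfer {Π′} _ = isRisingOn⇔ (insertTops ps Π′) Π′ (rising-insertTops-at ps Π′ ps≥1+n zero refl)
      where
      ps≥1+n : ∀ k → suc n ≤ toℕ (lookup ps k)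
      ps≥1+n k = ≤-reflexive (sym (trans (cong toℕ (ps≡last k)) toℕ-last))

  count-rising : (n : ℕ) → count isRising (Sd (suc n) (suc (suc m))) ≡ 1
  count-rising zero    = count-Sd-1 {suc m} isRising (λ Π → from (T-isRisingOn {M = 1} {Π}) (λ { (s≤s ()) }))
  count-rising (suc n) = trans (count-rising-suc {n}) (count-rising n)

bools : List Bool
bools = true ∷ false ∷ []

bools-unique : Unique bools
bools-unique = ((λ ()) ListAll.∷ ListAll.[]) AllPairs.∷ (ListAll.[] AllPairs.∷ AllPairs.[])

allTrue : {k : ℕ} → Vec Bool k → Bool
allTrue bs = all id (toList bs)

allTrue⇒lookup : {k : ℕ} (bs : Vec Bool k) → T (allTrue bs) → ∀ i → lookup bs i ≡ true
allTrue⇒lookup (true ∷ bs) t zero    = refl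
allTrue⇒lookup (true ∷ bs) t (suc i) = allTrue⇒lookup bs t i

¬allTrue⇒lookup : {k : ℕ} (bs : Vec Bool k) → ¬ T (allTrue bs) → ∃ λ i → lookup bs i ≡ false
¬allTrue⇒lookup []           ¬t = ⊥-elim (¬t tt)
¬allTrue⇒lookup (false ∷ bs) ¬t = zero , refl
¬allTrue⇒lookup (true ∷ bs)  ¬t = let i , bsᵢ≡false = ¬allTrue⇒lookup bs ¬t in suc i , bsᵢ≡false

count-allTrue : (k : ℕ) → count allTrue (allVecs bools k) ≡ 1
count-allTrue k = trans (count-allVecs id bools k) (^-zeroˡ k)

count-¬allTrue : (k : ℕ) → count (not ∘ allTrue) (allVecs bools k) ≡ 2 ^ k ∸ 1
count-¬allTrue k = sym (begin
  2 ^ k ∸ 1                                 ≡⟨ cong (_∸ 1) (length-allVecs bools k) ⟨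
  length vs ∸ 1                             ≡⟨ cong (_∸ 1) (count-all {p = λ _ → true} _ vs) ⟨
  count (λ _ → true) vs ∸ 1                 ≡⟨ cong (_∸ 1) (count-split (λ _ → true) allTrue vs) ⟩
  count allTrue vs + count ¬all vs ∸ 1      ≡⟨ cong (λ c → c + count ¬all vs ∸ 1) (count-allTrue k) ⟩
  1 + count ¬all vs ∸ 1                     ≡⟨ m+n∸m≡n 1 (count ¬all vs) ⟩
  count ¬all vs                             ∎)
  where
  open ≡-Reasoning
  vs = allVecs bools k
  ¬all = not ∘ allTrue

module _ {n : ℕ} where

  position : Bool → Fin (suc (suc n))
  position b = if b then last else penultimate

  n≤position : (b : Bool) → n ≤ toℕ (position b)
  n≤position true  = subst (n ≤_) (sym toℕ-last) (n≤1+n n)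
  n≤position false = subst (n ≤_) (sym toℕ-penultimate) ≤-refl

  atLast : Vec (Fin (suc (suc n))) (suc (suc n)) → Bool
  atLast π = ⌊ lookup π last ≟ top ⌋

  atLast-insertTop : (b : Bool) (π : Vec (Fin (suc n)) (suc n)) → atLast (insertTop (position b) π) ≡ b
  atLast-insertTop true π with lookup (insertTop last π) last ≟ top
  ... | yes _  = refl
  ... | no ¬at = ⊥-elim (¬at (Vec.insertAt-lookup (Vec.map inject₁ π) last top))
  atLast-insertTop false π with lookup (insertTop penultimate π) last ≟ top
  ... | no _   = refl
  ... | yes at = ⊥-elim (1+n≰n (subst (_≤ n) (trans (cong toℕ at) (toℕ-fromℕ (suc n))) below))
    where below = toℕ-lookup-insertTop-≢ penultimate π penultimate≢last

map-atLast-insertTops : {m n : ℕ} (bs : Vec Bool m) (Π′ : Tuple m (suc n)) →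
                        Vec.map atLast (insertTops (Vec.map position bs) Π′) ≡ bs
map-atLast-insertTops []       []       = refl
map-atLast-insertTops (b ∷ bs) (π ∷ Π′) = cong₂ _∷_ (atLast-insertTop b π) (map-atLast-insertTops bs Π′)

module _ {m n : ℕ} where

  -- Π′ is what remains after deleting the tops, whose positions (n or n + 1) are recorded by bs.
  remainderRising : Vec Bool (suc m) × Tuple (suc m) (suc n) → Bool
  remainderRising (bs , Π′) = isRisingOn (if allTrue bs then suc n else n) Π′

  count-risingButLast-insertTops :
    count isRisingButLast (Sd (suc (suc n)) (suc (suc m)))
    ≡ count remainderRising (cartesianProduct (allVecs bools (suc m)) (Sd (suc n) (suc (suc m))))
  count-risingButLast-insertTops =
    count-insertTops (allVecs⁺ bools-unique (suc m)) (Vec.map position) (Vec.map atLast) tag∈ map-atLast-insertTops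
                     isRisingButLast (curry remainderRising) tops transfer
    where
    bool∈ : (b : Bool) → b ∈ bools
    bool∈ true  = here refl
    bool∈ false = there (here refl)

    tag∈ : (Π : Tuple (suc m) (suc (suc n))) → Vec.map atLast Π ∈ allVecs bools (suc m)
    tag∈ Π = ∈-allVecs⁺ (All.universal bool∈ (Vec.map atLast Π))

    position-atLast : (Π : Tuple (suc m) (suc (suc n))) (k : Fin (suc m)) →
                      lookup (Vec.map position (Vec.map atLast Π)) k ≡ position (atLast (lookup Π k))
    position-atLast Π k = trans (Vec.lookup-map k position (Vec.map atLast Π)) (cong position (Vec.lookup-map k atLast Π))

    tops : ∀ {Π} → AllPerms Π → T (isRisingButLast Π) → TopsAt (Vec.map position (Vec.map atLast Π)) Π
    tops {Π} perms rising k with lookup (lookup Π k) last ≟ top | position-atLast Π k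
    ... | yes at | ps≡last = top-at {π = lookup Π k} at toℕ-last ps≡last
    ... | no ¬at | ps≡penultimate with top-position-≥ perms (to (T-isRisingOn {Π = Π}) rising) k
    ... | c , c-top , n≤c = top-at {π = lookup Π k} c-top (toℕ≡penultimate c n≤c c≢last) ps≡penultimate
      where
      c≢last : toℕ c ≢ suc n
      c≢last c≡last = ¬at (top-at {π = lookup Π k} c-top c≡last refl)

    transfer : ∀ bs {Π′} → AllPerms Π′ →
               T (isRisingButLast (insertTops (Vec.map position bs) Π′)) ⇔ T (remainderRising (bs , Π′))
    transfer bs {Π′} _ = isRisingOn⇔ (insertTops ps Π′) Π′ (rising⇔ (allTrue bs) refl)
      where
      ps = Vec.map position bs
      ps≡position : ∀ k → lookup ps k ≡ position (lookup bs k)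
      ps≡position k = Vec.lookup-map k position bs
      rising⇔ : ∀ b → allTrue bs ≡ b →
                Increasing (level (insertTops ps Π′)) (suc n) ⇔ Increasing (level Π′) (if b then suc n else n)
      rising⇔ true all-last = rising-insertTops-above ps Π′ ps≥1+n
        where
        ps≥1+n : ∀ k → suc n ≤ toℕ (lookup ps k)
        ps≥1+n k = ≤-reflexive (sym (trans (cong toℕ (trans (ps≡position k) (cong position bsₖ≡true))) toℕ-last))
          where bsₖ≡true = allTrue⇒lookup bs (subst T (sym all-last) tt) k
      rising⇔ false ¬all-last = rising-insertTops-at ps Π′ ps≥n k (trans (ps≡position k) (cong position bsₖ≡false))
        where
        ps≥n : ∀ k → n ≤ toℕ (lookup ps k)
        ps≥n k = subst (n ≤_) (sym (cong toℕ (ps≡position k))) (n≤position (lookup bs k))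
        k = proj₁ (¬allTrue⇒lookup bs (subst T ¬all-last))
        bsₖ≡false = proj₂ (¬allTrue⇒lookup bs (subst T ¬all-last))

  count-risingButLast-suc :
    count isRisingButLast (Sd (suc (suc n)) (suc (suc m)))
    ≡ count isRising (Sd (suc n) (suc (suc m))) + (2 ^ suc m ∸ 1) * count isRisingButLast (Sd (suc n) (suc (suc m)))
  count-risingButLast-suc = begin
    count isRisingButLast (Sd (suc (suc n)) (suc (suc m)))
      ≡⟨ count-risingButLast-insertTops ⟩
    count remainderRising (cartesianProduct bits L)
      ≡⟨ count-split remainderRising (allTrue ∘ proj₁) (cartesianProduct bits L) ⟩
    count (λ z → remainderRising z ∧ allTrue (proj₁ z)) (cartesianProduct bits L)
      + count (λ z → remainderRising z ∧ not (allTrue (proj₁ z))) (cartesianProduct bits L)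
      ≡⟨ cong₂ _+_ (count-cong all-last (cartesianProduct bits L)) (count-cong ¬all-last (cartesianProduct bits L)) ⟩
    count (λ z → allTrue (proj₁ z) ∧ isRising (proj₂ z)) (cartesianProduct bits L)
      + count (λ z → not (allTrue (proj₁ z)) ∧ isRisingButLast (proj₂ z)) (cartesianProduct bits L)
      ≡⟨ cong₂ _+_ (count-cartesianProductWith _,_ (λ _ _ → refl) bits L)
                   (count-cartesianProductWith _,_ (λ _ _ → refl) bits L) ⟩
    count allTrue bits * count isRising L + count (not ∘ allTrue) bits * count isRisingButLast L
      ≡⟨ cong₂ _+_ (trans (cong (_* count isRising L) (count-allTrue (suc m))) (+-identityʳ _))
                   (cong (_* count isRisingButLast L) (count-¬allTrue (suc m))) ⟩
    count isRising L + (2 ^ suc m ∸ 1) * count isRisingButLast L ∎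
    where
    open ≡-Reasoning
    bits = allVecs bools (suc m)
    L = Sd (suc n) (suc (suc m))
    all-last : ∀ z → remainderRising z ∧ allTrue (proj₁ z) ≡ allTrue (proj₁ z) ∧ isRising (proj₂ z)
    all-last (bs , Π′) with allTrue bs
    ... | true  = ∧-identityʳ _
    ... | false = ∧-zeroʳ _
    ¬all-last : ∀ z → remainderRising z ∧ not (allTrue (proj₁ z))
                    ≡ not (allTrue (proj₁ z)) ∧ isRisingButLast (proj₂ z)
    ¬all-last (bs , Π′) with allTrue bs
    ... | true  = ∧-zeroʳ _
    ... | false = ∧-identityʳ _

geometric : ℕ → ℕ → ℕ
geometric a j = sum (List.map (a ^_) (upTo j))

sum-map-* : (a : ℕ) (xs : List ℕ) → sum (List.map (a *_) xs) ≡ a * sum xs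
sum-map-* a []       = sym (*-zeroʳ a)
sum-map-* a (x ∷ xs) = trans (cong (a * x +_) (sum-map-* a xs)) (sym (*-distribˡ-+ a x (sum xs)))

geometric-suc : (a j : ℕ) → geometric a (suc j) ≡ 1 + a * geometric a j
geometric-suc a j = cong (1 +_) (begin
  sum (List.map (a ^_) (applyUpTo suc j))            ≡⟨ cong sum (map-applyUpTo suc (a ^_) j) ⟩
  sum (applyUpTo (λ k → a * a ^ k) j)                ≡⟨ cong sum (map-applyUpTo (a ^_) (a *_) j) ⟨
  sum (List.map (a *_) (applyUpTo (a ^_) j))         ≡⟨ cong (sum ∘ List.map (a *_)) (map-applyUpTo id (a ^_) j) ⟨
  sum (List.map (a *_) (List.map (a ^_) (upTo j)))   ≡⟨ sum-map-* a (List.map (a ^_) (upTo j)) ⟩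
  a * geometric a j                                  ∎)
  where open ≡-Reasoning

count-risingButLast : {m : ℕ} (n : ℕ) →
                      count isRisingButLast (Sd (suc n) (suc (suc m))) ≡ geometric (2 ^ suc m ∸ 1) (suc n)
count-risingButLast {m} zero = count-Sd-1 {suc m} isRisingButLast (λ Π → from (T-isRisingOn {M = 0} {Π}) λ ())
count-risingButLast {m} (suc n) = begin
  count isRisingButLast (Sd (suc (suc n)) (suc (suc m)))
    ≡⟨ count-risingButLast-suc {m} {n} ⟩
  count isRising (Sd (suc n) (suc (suc m))) + a * count isRisingButLast (Sd (suc n) (suc (suc m)))
    ≡⟨ cong₂ (λ r h → r + a * h) (count-rising n) (count-risingButLast n) ⟩
  1 + a * geometric a (suc n)
    ≡⟨ geometric-suc a (suc n) ⟨
  geometric a (suc (suc n)) ∎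
  where
  open ≡-Reasoning
  a = 2 ^ suc m ∸ 1

theorem3p14 : (n d : ℕ) → 2 ≤ n → 2 ≤ d → H n d ≡ rhs n d
theorem3p14 (suc (suc n)) (suc (suc m)) (s≤s (s≤s _)) (s≤s (s≤s _)) = begin
  H (2 + n) (2 + m)                           ≡⟨ count-hoe {m} {n} ⟩
  count isRisingButLast (Sd (1 + n) (2 + m))  ≡⟨ count-risingButLast n ⟩
  rhs (2 + n) (2 + m)                         ∎
  where open ≡-Reasoning
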